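{- For all $n\ge0$, $a(n)\equiv \lfloor n\varphi\rfloor \pmod 2$.
   Context: $\varphi=(1+\sqrt5)/2$. Fibonacci numbers: $F_0=0$, $F_1=1$, $F_n=F_{n-1}+F_{n-2}$. The sequence $(a(n))_{n\geq 0}$ (OEIS A105774) is defined by $a(n)=n$ for $n\le 1$, and $a(n)=F_{j+1}-a(n-F_j)$ if $F_j<n\le F_{j+1}$ with $j\ge 2$. -}

module Defs where

open import Data.Nat using (ℕ; zero; suc; _+_; _*_; _∸_; _≤_; _<_; _≤ᵇ_)
open import Data.Bool using (if_then_else_)
open import Data.Integer as ℤ using (ℤ; +_)
open import Data.Product using (_×_)

fib : ℕ → ℕ
fib zero = zero
fib (suc zero) = suc zero
fib (suc (suc n)) = fib (suc n) + fib n

-- Started at j = 2 for n ≥ 2 (so F_2 = 1 < n), it returns the unique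
-- j ≥ 2 with F_j < n ≤ F_{j+1} (fuel n suffices since F_{j+1} ≥ j).
findJ : ℕ → ℕ → ℕ → ℕ
findJ zero j n = j
findJ (suc f) j n = if n ≤ᵇ fib (suc j) then j else findJ f (suc j) n

fibIndex : ℕ → ℕ
fibIndex n = findJ n 2 n

-- aux fuel n computes a(n) (values in ℤ, so the subtraction is genuine).
-- Each recursive call decreases n by F_j ≥ 1, so fuel n suffices.
aux : ℕ → ℕ → ℤ
aux zero n = + n
aux (suc f) zero = + 0
aux (suc f) (suc zero) = + 1
aux (suc f) (suc (suc k)) =
  let n = suc (suc k) ; j = fibIndex n in
  (+ fib (suc j)) ℤ.- aux f (n ∸ fib j)

-- OEIS A105774
a : ℕ → ℤ
a n = aux n n

-- IsFloorNφ n m  :⇔  m = ⌊ n φ ⌋, i.e.  m ≤ n(1+√5)/2 < m + 1,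
-- written with exact integer arithmetic:
--   m ≤ n(1+√5)/2      ⇔  (2m ∸ n)² ≤ 5n²
--   n(1+√5)/2 < m + 1  ⇔  n < 2(m+1)  and  5n² < (2(m+1) ∸ n)²
IsFloorNφ : ℕ → ℕ → Set
IsFloorNφ n m =
  ((2 * m ∸ n) * (2 * m ∸ n) ≤ 5 * (n * n)) ×
  (n < 2 * (m + 1) × 5 * (n * n) < (2 * (m + 1) ∸ n) * (2 * (m + 1) ∸ n))

-- Write n = r + Fⱼ with Fⱼ < n ≤ Fⱼ₊₁, so that 0 < r ≤ Fⱼ₋₁. The key fact is
-- ⌊nφ⌋ = ⌊rφ⌋ + Fⱼ₊₁: together with a(n) = Fⱼ₊₁ − a(r) it gives
-- a(n) − ⌊nφ⌋ = −(a(r) + ⌊rφ⌋) ≡ a(r) − ⌊rφ⌋ (mod 2), and induction on n finishes.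
--
-- ⌊rφ⌋ = m means that (r , m) lies below and (r , m + 1) above the line y = φx, so the key fact
-- follows once adding (Fⱼ , Fⱼ₊₁) to a point (u , v) with 0 < u ≤ Fⱼ₋₁ never changes its side.
-- The unimodular map (x , y) ↦ (y , x + y) multiplies y − φx by 1 − φ < 0. Writing (u , v) as
-- the image of some (x , y) under its (j − 1)-st power, the translation becomes
-- (x , y) ↦ (x + 1 , y + 1), and the bound on u confines (x , y) to a region this unit step
-- never carries across the line. Sides are decided in exact integer arithmetic through the
-- norm y² − xy − x².

module Submission where

open import Data.Nat using (ℕ)
open import Data.Integer using (+_; _-_)
open import Data.Integer.Divisibility using (_∣_)
open import Data.Product using (Σ; _×_)
open import Defs

module FibonacciFacts where

  open import Data.Nat
  open import Data.Nat.Properties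
  open import Data.Product using (_,_)
  open import Data.Bool using (true; false; T)
  open import Data.Unit using (tt)
  open import Relation.Binary.PropositionalEquality

  0<fib-suc : ∀ i → 0 < fib (suc i)
  0<fib-suc zero    = s≤s z≤n
  0<fib-suc (suc i) = <-≤-trans (0<fib-suc i) (m≤m+n (fib (suc i)) (fib i))

  n≤fib[2+n] : ∀ n → n ≤ fib (2 + n)
  n≤fib[2+n] zero    = z≤n
  n≤fib[2+n] (suc n) = subst (_≤ fib (2 + n) + fib (suc n)) (+-comm n 1)
                         (+-mono-≤ (n≤fib[2+n] n) (0<fib-suc n))

  FibBracket : ℕ → ℕ → Set
  FibBracket j n = fib j < n × n ≤ fib (suc j)

  findJ-spec : ∀ fuel j n → fib j < n → n ≤ fib (suc (j + fuel)) →
               j ≤ findJ fuel j n × FibBracket (findJ fuel j n) n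
  findJ-spec zero j n F<n n≤F =
    ≤-refl , F<n , subst (λ k → n ≤ fib (suc k)) (+-identityʳ j) n≤F
  findJ-spec (suc fuel) j n F<n n≤F with n ≤ᵇ fib (suc j) in eq
  ... | true  = ≤-refl , F<n , ≤ᵇ⇒≤ n _ (subst T (sym eq) tt)
  ... | false with findJ-spec fuel (suc j) n (≰⇒> λ n≤F′ → subst T eq (≤⇒≤ᵇ n≤F′))
                                      (subst (λ k → n ≤ fib (suc k)) (+-suc j fuel) n≤F)
  ...   | j<r , bracket = <⇒≤ j<r , bracket

  fibIndex-spec : ∀ k → Σ ℕ λ i → fibIndex (2 + k) ≡ 2 + i × FibBracket (2 + i) (2 + k)
  fibIndex-spec k with fibIndex (2 + k) | findJ-spec (2 + k) 2 (2 + k) (s≤s (s≤s z≤n)) 2+k≤F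
    where
    2+k≤F : 2 + k ≤ fib (5 + k)
    2+k≤F = ≤-trans (n≤fib[2+n] (2 + k)) (m≤m+n (fib (4 + k)) (fib (3 + k)))
  ... | suc (suc i) | s≤s (s≤s z≤n) , bracket = i , refl , bracket

module GoldenSection where

  open import Data.Integer
  open import Data.Integer.Properties
  open import Data.Integer.Tactic.RingSolver using (solve-∀)
  import Data.Nat as ℕ
  open import Data.Empty using (⊥-elim)
  open import Data.Product using (_×_; _,_)
  open import Data.Sum using (_⊎_; inj₁; inj₂)
  open import Relation.Nullary using (¬_; yes; no; contradiction)
  open import Relation.Binary.PropositionalEquality

  <-exchange : ∀ {a b c d} → a < b → b + c ≡ a + d → c < d
  <-exchange {a} {b} {c} {d} a<b eq =
    subst₂ _<_ (cancel a c) (trans (regroup a b c) (trans (cong (_- a) eq) (cancel′ a d)))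
      (+-monoˡ-< (c - a) a<b)
    where
    cancel : ∀ a c → a + (c - a) ≡ c
    cancel = solve-∀
    regroup : ∀ a b c → b + (c - a) ≡ (b + c) - a
    regroup = solve-∀
    cancel′ : ∀ a d → (a + d) - a ≡ d
    cancel′ = solve-∀

  0<i*i : ∀ {i} → i ≢ 0ℤ → 0ℤ < i * i
  0<i*i {+0}       i≢0 = contradiction refl i≢0
  0<i*i {+[1+ n ]} _   = +<+ (ℕ.s≤s ℕ.z≤n)
  0<i*i { -[1+ n ]} _  = +<+ (ℕ.s≤s ℕ.z≤n)

  nonNeg*nonPos≤0 : ∀ {i j} → 0ℤ ≤ i → j ≤ 0ℤ → i * j ≤ 0ℤ
  nonNeg*nonPos≤0 {i} 0≤i j≤0 =
    subst (i * _ ≤_) (*-zeroʳ i) (*-monoˡ-≤-nonNeg i {{nonNegative 0≤i}} j≤0)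

  nonPos*nonNeg≤0 : ∀ {i j} → i ≤ 0ℤ → 0ℤ ≤ j → i * j ≤ 0ℤ
  nonPos*nonNeg≤0 {i} {j} i≤0 0≤j =
    subst (i * j ≤_) (*-zeroˡ j) (*-monoʳ-≤-nonNeg j {{nonNegative 0≤j}} i≤0)

  nonNeg*nonNeg≥0 : ∀ {i j} → 0ℤ ≤ i → 0ℤ ≤ j → 0ℤ ≤ i * j
  nonNeg*nonNeg≥0 {i} 0≤i 0≤j =
    subst (_≤ i * _) (*-zeroʳ i) (*-monoˡ-≤-nonNeg i {{nonNegative 0≤i}} 0≤j)

  -- y² − xy − x² = (y − φx)(y − ψx) with ψ = 1 − φ < 0; the side predicates below read
  -- off the sign of y − φx from the signs of x, y and of this norm.
  NormNeg NormPos : ℤ → ℤ → Set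
  NormNeg x y = y * y < x * y + x * x
  NormPos x y = x * y + x * x < y * y

  normNeg-rotate : ∀ x y → NormNeg x y → NormPos y (x + y)
  normNeg-rotate x y n = <-exchange n (identity x y)
    where
    identity : ∀ x y → (x * y + x * x) + (y * (x + y) + y * y) ≡ y * y + (x + y) * (x + y)
    identity = solve-∀

  normPos-rotate : ∀ x y → NormPos x y → NormNeg y (x + y)
  normPos-rotate x y n = <-exchange n (identity x y)
    where
    identity : ∀ x y → y * y + (x + y) * (x + y) ≡ (x * y + x * x) + (y * (x + y) + y * y)
    identity = solve-∀

  normNeg-if : ∀ x y → x ≢ 0ℤ → y * y ≤ x * y → NormNeg x y
  normNeg-if x y x≢0 yy≤xy =
    ≤-<-trans yy≤xy
      (subst (_< x * y + x * x) (+-identityʳ (x * y)) (+-monoʳ-< (x * y) (0<i*i x≢0)))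

  normPos-if : ∀ x y → y ≢ 0ℤ → x * (x + y) ≤ 0ℤ → NormPos x y
  normPos-if x y y≢0 x[x+y]≤0 = ≤-<-trans (subst (_≤ 0ℤ) (expand x y) x[x+y]≤0) (0<i*i y≢0)
    where
    expand : ∀ x y → x * (x + y) ≡ x * y + x * x
    expand = solve-∀

  infix 4 _<φ·_ φ·_<_

  _<φ·_ : ℤ → ℤ → Set
  y <φ· x = (y < 0ℤ × (0ℤ ≤ x ⊎ NormPos x y)) ⊎ (0ℤ ≤ y × 0ℤ < x × NormNeg x y)

  φ·_<_ : ℤ → ℤ → Set
  φ· x < y = (0ℤ < y × (x ≤ 0ℤ ⊎ NormPos x y)) ⊎ (y ≤ 0ℤ × x < 0ℤ × NormNeg x y)

  <φ·-rotate : ∀ {x y} → y <φ· x → φ· y < x + y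
  <φ·-rotate {x} {y} (inj₂ (0≤y , 0<x , n)) =
    inj₁ (+-mono-<-≤ 0<x 0≤y , inj₂ (normNeg-rotate x y n))
  <φ·-rotate {x} {y} (inj₁ (y<0 , side)) with x + y ≤? 0ℤ
  ... | no  x+y≰0 = inj₁ (≰⇒> x+y≰0 , inj₁ (<⇒≤ y<0))
  ... | yes x+y≤0 = inj₂ (x+y≤0 , y<0 , normPos-rotate x y (normPos side))
    where
    normPos : 0ℤ ≤ x ⊎ NormPos x y → NormPos x y
    normPos (inj₁ 0≤x) = normPos-if x y (<⇒≢ y<0) (nonNeg*nonPos≤0 0≤x x+y≤0)
    normPos (inj₂ n)   = n

  φ·<-rotate : ∀ {x y} → φ· x < y → x + y <φ· y
  φ·<-rotate {x} {y} (inj₂ (y≤0 , x<0 , n)) =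
    inj₁ (+-mono-<-≤ x<0 y≤0 , inj₂ (normNeg-rotate x y n))
  φ·<-rotate {x} {y} (inj₁ (0<y , side)) with 0ℤ ≤? x + y
  ... | no  0≰x+y = inj₁ (≰⇒> 0≰x+y , inj₁ (<⇒≤ 0<y))
  ... | yes 0≤x+y = inj₂ (0≤x+y , 0<y , normPos-rotate x y (normPos side))
    where
    normPos : x ≤ 0ℤ ⊎ NormPos x y → NormPos x y
    normPos (inj₁ x≤0) = normPos-if x y (≢-sym (<⇒≢ 0<y)) (nonPos*nonNeg≤0 x≤0 0≤x+y)
    normPos (inj₂ n)   = n

  <φ·⇒φ·≮ : ∀ {x y} → y <φ· x → ¬ φ· x < y
  <φ·⇒φ·≮ (inj₁ (y<0 , _))           (inj₁ (0<y , _))           = <-asym y<0 0<y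
  <φ·⇒φ·≮ (inj₁ (_ , inj₁ 0≤x))      (inj₂ (_ , x<0 , _))       = <⇒≱ x<0 0≤x
  <φ·⇒φ·≮ (inj₁ (_ , inj₂ pos))      (inj₂ (_ , _ , neg))       = <-asym pos neg
  <φ·⇒φ·≮ (inj₂ (_ , 0<x , _))       (inj₁ (_ , inj₁ x≤0))      = <⇒≱ 0<x x≤0
  <φ·⇒φ·≮ (inj₂ (_ , _ , neg))       (inj₁ (_ , inj₂ pos))      = <-asym pos neg
  <φ·⇒φ·≮ (inj₂ (_ , 0<x , _))       (inj₂ (_ , x<0 , _))       = <-asym 0<x x<0

  y≤x⇒y<φ·x : ∀ {x y} → 0ℤ < x → y ≤ x → y <φ· x
  y≤x⇒y<φ·x {x} {y} 0<x y≤x with y <? 0ℤ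
  ... | yes y<0 = inj₁ (y<0 , inj₁ (<⇒≤ 0<x))
  ... | no  y≮0 = inj₂ (0≤y , 0<x ,
    normNeg-if x y (≢-sym (<⇒≢ 0<x)) (*-monoʳ-≤-nonNeg y {{nonNegative 0≤y}} y≤x))
    where
    0≤y : 0ℤ ≤ y
    0≤y = ≮⇒≥ y≮0

  x≤y⇒φ·x<y : ∀ {x y} → x < 0ℤ → x ≤ y → φ· x < y
  x≤y⇒φ·x<y {x} {y} x<0 x≤y with 0ℤ <? y
  ... | yes 0<y = inj₁ (0<y , inj₁ (<⇒≤ x<0))
  ... | no  0≮y = inj₂ (y≤0 , x<0 ,
    normNeg-if x y (<⇒≢ x<0) (*-monoʳ-≤-nonPos y {{nonPositive y≤0}} x≤y))
    where
    y≤0 : y ≤ 0ℤ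
    y≤0 = ≮⇒≥ 0≮y

  x≤0<y⇒φ·x<y : ∀ {x y} → x ≤ 0ℤ → 0ℤ < y → φ· x < y
  x≤0<y⇒φ·x<y x≤0 0<y = inj₁ (0<y , inj₁ x≤0)

  φ·1<2 : φ· + 1 < + 2
  φ·1<2 = inj₁ (+<+ (ℕ.s≤s ℕ.z≤n) , inj₂ (+<+ (ℕ.s≤s (ℕ.s≤s (ℕ.s≤s (ℕ.s≤s ℕ.z≤n))))))

  data Side : Set where
    below above : Side

  opposite : Side → Side
  opposite below = above
  opposite above = below

  flipped : ℕ.ℕ → Side → Side
  flipped ℕ.zero    s = s
  flipped (ℕ.suc t) s = opposite (flipped t s)

  OnSide : Side → ℤ → ℤ → Set
  OnSide below x y = y <φ· x
  OnSide above x y = φ· x < y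

  OnSide-rotate : ∀ s {x y} → OnSide s x y → OnSide (opposite s) y (x + y)
  OnSide-rotate below = <φ·-rotate
  OnSide-rotate above = φ·<-rotate

  OnSide-unique : ∀ s t {x y} → OnSide s x y → OnSide t x y → s ≡ t
  OnSide-unique below below _ _ = refl
  OnSide-unique above above _ _ = refl
  OnSide-unique below above p q = ⊥-elim (<φ·⇒φ·≮ p q)
  OnSide-unique above below p q = ⊥-elim (<φ·⇒φ·≮ q p)

module FibonacciRotation where

  open import Data.Integer
  open import Data.Integer.Properties
  open import Data.Integer.Tactic.RingSolver using (solve-∀)
  import Data.Nat as ℕ
  open import Data.Empty using (⊥-elim)
  open import Data.Product using (Σ; _×_; _,_)
  open import Relation.Nullary using (yes; no)
  open import Relation.Binary.PropositionalEquality
  open FibonacciFacts using (0<fib-suc)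
  open GoldenSection

  F : ℕ.ℕ → ℤ
  F t = + fib t

  -- Fₜ₋₁, with the convention F₋₁ = 1.
  F-pred : ℕ.ℕ → ℤ
  F-pred ℕ.zero    = 1ℤ
  F-pred (ℕ.suc t) = F t

  F-pred+F : ∀ t → F-pred t + F t ≡ F (ℕ.suc t)
  F-pred+F ℕ.zero    = refl
  F-pred+F (ℕ.suc t) = trans (+-comm (F t) (F (ℕ.suc t))) (sym (pos-+ (fib (ℕ.suc t)) (fib t)))

  F-suc+F : ∀ t → F (ℕ.suc t) + F t ≡ F (ℕ.suc (ℕ.suc t))
  F-suc+F t = sym (pos-+ (fib (ℕ.suc t)) (fib t))

  -- (rot₁ t x y , rot₂ t x y) is the image of (x , y) under the t-th power of
  -- (x , y) ↦ (y , x + y).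
  rot₁ rot₂ : ℕ.ℕ → ℤ → ℤ → ℤ
  rot₁ t x y = x * F-pred t + y * F t
  rot₂ t x y = x * F t + y * F (ℕ.suc t)

  rot₂-suc : ∀ t x y → rot₂ (ℕ.suc t) x y ≡ rot₁ t x y + rot₂ t x y
  rot₂-suc t x y = begin
    x * F (ℕ.suc t) + y * F (ℕ.suc (ℕ.suc t))
      ≡⟨ sym (cong₂ (λ a b → x * a + y * b) (F-pred+F t) (F-suc+F t)) ⟩
    x * (F-pred t + F t) + y * (F (ℕ.suc t) + F t)
      ≡⟨ regroup x y (F-pred t) (F t) (F (ℕ.suc t)) ⟩
    rot₁ t x y + rot₂ t x y ∎
    where
    open ≡-Reasoning
    regroup : ∀ x y a b c → x * (a + b) + y * (c + b) ≡ (x * a + y * b) + (x * b + y * c)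
    regroup = solve-∀

  rot-zero : ∀ x y → rot₁ ℕ.zero x y ≡ x × rot₂ ℕ.zero x y ≡ y
  rot-zero x y = identity₁ x y , identity₂ x y
    where
    identity₁ : ∀ x y → x * 1ℤ + y * 0ℤ ≡ x
    identity₁ = solve-∀
    identity₂ : ∀ x y → x * 0ℤ + y * 1ℤ ≡ y
    identity₂ = solve-∀

  OnSide-rot : ∀ t s {x y} → OnSide s x y → OnSide (flipped t s) (rot₁ t x y) (rot₂ t x y)
  OnSide-rot ℕ.zero s {x} {y} side with rot-zero x y
  ... | eq₁ , eq₂ = subst₂ (OnSide s) (sym eq₁) (sym eq₂) side
  OnSide-rot (ℕ.suc t) s {x} {y} side =
    subst (OnSide _ _) (sym (rot₂-suc t x y)) (OnSide-rotate (flipped t s) (OnSide-rot t s side))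

  rot-surjective : ∀ t m c → Σ ℤ λ x → Σ ℤ λ y → rot₁ t x y ≡ m × rot₂ t x y ≡ c
  rot-surjective ℕ.zero m c = m , c , rot-zero m c
  rot-surjective (ℕ.suc t) m c with rot-surjective t (c - m) m
  ... | x , y , eq₁ , eq₂ = x , y , eq₂ , (begin
    rot₂ (ℕ.suc t) x y          ≡⟨ rot₂-suc t x y ⟩
    rot₁ t x y + rot₂ t x y     ≡⟨ cong₂ _+_ eq₁ eq₂ ⟩
    (c - m) + m                 ≡⟨ cancel c m ⟩
    c                           ∎)
    where
    open ≡-Reasoning
    cancel : ∀ c m → (c - m) + m ≡ c
    cancel = solve-∀

  translate-expand : ∀ x y a b → (1ℤ + x) * a + (1ℤ + y) * b ≡ (x * a + y * b) + (a + b)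
  translate-expand = solve-∀

  rot₁-translate : ∀ t x y → rot₁ t (1ℤ + x) (1ℤ + y) ≡ rot₁ t x y + F (ℕ.suc t)
  rot₁-translate t x y =
    trans (translate-expand x y (F-pred t) (F t)) (cong (_+_ (rot₁ t x y)) (F-pred+F t))

  rot₂-translate : ∀ t x y → rot₂ t (1ℤ + x) (1ℤ + y) ≡ rot₂ t x y + F (ℕ.suc (ℕ.suc t))
  rot₂-translate t x y = trans (translate-expand x y (F t) (F (ℕ.suc t)))
    (cong (_+_ (rot₂ t x y)) (trans (+-comm (F t) (F (ℕ.suc t))) (F-suc+F t)))

  rot₁-negative : ∀ i x y → x ≤ 0ℤ → y < 0ℤ → rot₁ (ℕ.suc i) x y < 0ℤ
  rot₁-negative i x y x≤0 y<0 =
    +-mono-≤-< (nonPos*nonNeg≤0 x≤0 (+≤+ ℕ.z≤n))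
               (*-monoʳ-<-pos (F (ℕ.suc i)) {{F-suc-positive}} y<0)
    where
    F-suc-positive : Positive (F (ℕ.suc i))
    F-suc-positive = positive (+<+ (0<fib-suc i))

  F-suc<rot₁ : ∀ i x y → 0ℤ ≤ x → + 2 ≤ y → F (ℕ.suc i) < rot₁ (ℕ.suc i) x y
  F-suc<rot₁ i x y 0≤x 2≤y = begin-strict
    f                ≡⟨ sym (+-identityʳ f) ⟩
    f + 0ℤ           <⟨ +-monoʳ-< f 0<f ⟩
    f + f            ≡⟨ double f ⟩
    + 2 * f          ≤⟨ *-monoʳ-≤-nonNeg f {{nonNegative (<⇒≤ 0<f)}} 2≤y ⟩
    y * f            ≤⟨ i≤j⇒i≤k+j (x * F i) {{nonNegative 0≤x*F}} ≤-refl ⟩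
    x * F i + y * f  ∎
    where
    open ≤-Reasoning
    f = F (ℕ.suc i)
    0<f : 0ℤ < f
    0<f = +<+ (0<fib-suc i)
    0≤x*F : 0ℤ ≤ x * F i
    0≤x*F = nonNeg*nonNeg≥0 0≤x (+≤+ ℕ.z≤n)
    double : ∀ a → a + a ≡ + 2 * a
    double = solve-∀

  -- The bounds leave only the cases y ≤ x with 0 < x, (x , y) = (0 , 1), and x < 0 ≤ y.
  sameSide-+1 : ∀ i x y → 0ℤ < rot₁ (ℕ.suc i) x y → rot₁ (ℕ.suc i) x y ≤ F (ℕ.suc i) →
             Σ Side λ s → OnSide s x y × OnSide s (1ℤ + x) (1ℤ + y)
  sameSide-+1 i x@(+[1+ _ ]) y 0<m m≤F with y ≤? x
  ... | yes y≤x =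
    below , y≤x⇒y<φ·x (+<+ (ℕ.s≤s ℕ.z≤n)) y≤x , y≤x⇒y<φ·x (+<+ (ℕ.s≤s ℕ.z≤n)) (+-monoʳ-≤ 1ℤ y≤x)
  ... | no  y≰x = ⊥-elim (<⇒≱ (F-suc<rot₁ i x y (+≤+ ℕ.z≤n) 2≤y) m≤F)
    where
    2≤y : + 2 ≤ y
    2≤y = ≤-trans (+≤+ (ℕ.s≤s (ℕ.s≤s ℕ.z≤n))) (i<j⇒suc[i]≤j (≰⇒> y≰x))
  sameSide-+1 i +0 -[1+ k ] 0<m _ = ⊥-elim (<-asym 0<m (rot₁-negative i +0 -[1+ k ] ≤-refl -<+))
  sameSide-+1 i +0 +0 0<m _ = ⊥-elim (<-irrefl refl 0<m)
  sameSide-+1 i +0 (+ 1) _ _ = above , x≤0<y⇒φ·x<y ≤-refl (+<+ (ℕ.s≤s ℕ.z≤n)) , φ·1<2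
  sameSide-+1 i +0 (+ ℕ.suc (ℕ.suc k)) _ m≤F =
    ⊥-elim (<⇒≱ (F-suc<rot₁ i +0 (+ ℕ.suc (ℕ.suc k)) ≤-refl (+≤+ (ℕ.s≤s (ℕ.s≤s ℕ.z≤n)))) m≤F)
  sameSide-+1 i -[1+ n ] -[1+ k ] 0<m _ =
    ⊥-elim (<-asym 0<m (rot₁-negative i -[1+ n ] -[1+ k ] -≤+ -<+))
  sameSide-+1 i x@(-[1+ _ ]) (+ k) _ _ =
    above , x≤y⇒φ·x<y -<+ -≤+ , x≤0<y⇒φ·x<y (i<j⇒suc[i]≤j {x} -<+) (+<+ (ℕ.s≤s ℕ.z≤n))

  -- If (x , y) is rotated to (m , c), then (x + 1 , y + 1) is rotated to
  -- (m + Fᵢ₊₂ , c + Fᵢ₊₃).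
  OnSide-translate : ∀ i s {m c} → 0ℤ < m → m ≤ F (ℕ.suc i) → OnSide s m c →
                     OnSide s (m + F (ℕ.suc (ℕ.suc i))) (c + F (ℕ.suc (ℕ.suc (ℕ.suc i))))
  OnSide-translate i s {m} {c} 0<m m≤F side with rot-surjective (ℕ.suc i) m c
  ... | x , y , refl , refl with sameSide-+1 i x y 0<m m≤F
  ... | s′ , here , there = subst (λ s → OnSide s _ _) (sym s≡) translated
    where
    s≡ : s ≡ flipped (ℕ.suc i) s′
    s≡ = OnSide-unique s _ side (OnSide-rot (ℕ.suc i) s′ here)
    translated : OnSide (flipped (ℕ.suc i) s′) (rot₁ (ℕ.suc i) x y + F (ℕ.suc (ℕ.suc i)))
                                               (rot₂ (ℕ.suc i) x y + F (ℕ.suc (ℕ.suc (ℕ.suc i))))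
    translated = subst₂ (OnSide _) (rot₁-translate (ℕ.suc i) x y) (rot₂-translate (ℕ.suc i) x y)
                   (OnSide-rot (ℕ.suc i) s′ there)

open import Data.Nat
open import Data.Nat.Properties
open import Data.Nat.Tactic.RingSolver using (solve-∀)
open import Data.Nat.Induction using (<-rec)
import Data.Nat.Divisibility as ℕ
import Data.Integer as ℤ
import Data.Integer.Properties as ℤₚ
import Data.Integer.Tactic.RingSolver as ℤ-Solver
import Data.Integer.Divisibility.Signed as Signed
open import Data.Empty using (⊥-elim)
open import Data.Product using (_,_)
open import Data.Sum using (inj₁; inj₂)
open import Relation.Nullary using (yes; no)
open import Relation.Binary.PropositionalEquality
open FibonacciFacts
open GoldenSection
open FibonacciRotation

completing-square : ∀ n M e → e + n ≡ 2 * M →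
                    e * e + 4 * (n * M + n * n) ≡ 4 * (M * M) + 5 * (n * n)
completing-square n M e e+n≡2M = begin
  e * e + 4 * (n * M + n * n)             ≡⟨ cong (λ D → e * e + D) (split-M n M) ⟩
  e * e + (2 * n * (2 * M) + 4 * (n * n)) ≡⟨ cong (λ D → e * e + (2 * n * D + 4 * (n * n))) e+n≡2M ⟨
  e * e + (2 * n * (e + n) + 4 * (n * n)) ≡⟨ expand e n ⟩
  (e + n) * (e + n) + 5 * (n * n)         ≡⟨ cong (λ D → D * D + 5 * (n * n)) e+n≡2M ⟩
  (2 * M) * (2 * M) + 5 * (n * n)         ≡⟨ square-2M M n ⟩
  4 * (M * M) + 5 * (n * n)               ∎
  where
  open ≡-Reasoning
  split-M : ∀ n M → 4 * (n * M + n * n) ≡ 2 * n * (2 * M) + 4 * (n * n)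
  split-M = solve-∀
  expand : ∀ e n → e * e + (2 * n * (e + n) + 4 * (n * n)) ≡ (e + n) * (e + n) + 5 * (n * n)
  expand = solve-∀
  square-2M : ∀ M n → (2 * M) * (2 * M) + 5 * (n * n) ≡ 4 * (M * M) + 5 * (n * n)
  square-2M = solve-∀

[2m∸n]²≤5n² : ∀ n m → m * m < n * m + n * n → (2 * m ∸ n) * (2 * m ∸ n) ≤ 5 * (n * n)
[2m∸n]²≤5n² n m h with 2 * m ≤? n
... | yes 2m≤n rewrite m≤n⇒m∸n≡0 2m≤n = z≤n
... | no  2m≰n = <⇒≤ (+-cancelˡ-< (4 * (n * m + n * n)) (e * e) (5 * (n * n)) (begin-strict
  4 * (n * m + n * n) + e * e        ≡⟨ +-comm _ (e * e) ⟩
  e * e + 4 * (n * m + n * n)        ≡⟨ completing-square n m e (m∸n+n≡m (<⇒≤ (≰⇒> 2m≰n))) ⟩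
  4 * (m * m) + 5 * (n * n)          <⟨ +-monoˡ-< (5 * (n * n)) (*-monoʳ-< 4 h) ⟩
  4 * (n * m + n * n) + 5 * (n * n)  ∎))
  where
  open ≤-Reasoning
  e = 2 * m ∸ n

n<2M×5n²<[2M∸n]² : ∀ n M → n * M + n * n < M * M →
                   n < 2 * M × 5 * (n * n) < (2 * M ∸ n) * (2 * M ∸ n)
n<2M×5n²<[2M∸n]² n M h = n<2M ,
  +-cancelˡ-< (4 * (n * M + n * n)) (5 * (n * n)) (e * e) (begin-strict
  4 * (n * M + n * n) + 5 * (n * n)  <⟨ +-monoˡ-< (5 * (n * n)) (*-monoʳ-< 4 h) ⟩
  4 * (M * M) + 5 * (n * n)          ≡⟨ completing-square n M e (m∸n+n≡m (<⇒≤ n<2M)) ⟨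
  e * e + 4 * (n * M + n * n)        ≡⟨ +-comm (e * e) _ ⟩
  4 * (n * M + n * n) + e * e        ∎)
  where
  open ≤-Reasoning
  e = 2 * M ∸ n
  n<2M : n < 2 * M
  n<2M with 2 * M ≤? n
  ... | no  2M≰n = ≰⇒> 2M≰n
  ... | yes 2M≤n = ⊥-elim (<⇒≱ h (≤-trans (*-monoˡ-≤ M (≤-trans (m≤m+n M (M + 0)) 2M≤n))
                                          (m≤m+n (n * M) (n * n))))

pos-norm : ∀ n m → + n ℤ.* + m ℤ.+ + n ℤ.* + n ≡ + (n * m + n * n)
pos-norm n m =
  trans (cong₂ ℤ._+_ (sym (ℤₚ.pos-* n m)) (sym (ℤₚ.pos-* n n))) (sym (ℤₚ.pos-+ (n * m) (n * n)))

-- m < nφ < m + 1; both bounds are strict because nφ is irrational for n > 0.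
Floorφ : ℕ → ℕ → Set
Floorφ n m = + m <φ· + n × φ· + n < + suc m

Floorφ-1 : Floorφ 1 1
Floorφ-1 = y≤x⇒y<φ·x (ℤ.+<+ (s≤s z≤n)) ℤₚ.≤-refl , φ·1<2

Floorφ-translate : ∀ i {n m} → 0 < n → n ≤ fib (suc i) → Floorφ n m →
                   Floorφ (n + fib (2 + i)) (m + fib (3 + i))
Floorφ-translate i {n} {m} 0<n n≤F (lower , upper) =
  subst₂ _<φ·_ (sym (ℤₚ.pos-+ m _)) (sym (ℤₚ.pos-+ n _))
    (OnSide-translate i below (ℤ.+<+ 0<n) (ℤ.+≤+ n≤F) lower) ,
  subst₂ φ·_<_ (sym (ℤₚ.pos-+ n _)) (sym (ℤₚ.pos-+ (suc m) _))
    (OnSide-translate i above (ℤ.+<+ 0<n) (ℤ.+≤+ n≤F) upper)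

Floorφ⇒IsFloorNφ : ∀ {n m} → 0 < n → Floorφ n m → IsFloorNφ n m
Floorφ⇒IsFloorNφ {n} {m} 0<n (lower , upper) rewrite +-comm m 1 =
  [2m∸n]²≤5n² n m (m*m<n*m+n*n lower) , n<2M×5n²<[2M∸n]² n (suc m) (nM+nn<MM upper)
  where
  m*m<n*m+n*n : + m <φ· + n → m * m < n * m + n * n
  m*m<n*m+n*n (inj₁ (ℤ.+<+ () , _))
  m*m<n*m+n*n (inj₂ (_ , _ , neg)) =
    ℤₚ.drop‿+<+ (subst₂ ℤ._<_ (sym (ℤₚ.pos-* m m)) (pos-norm n m) neg)
  nM+nn<MM : φ· + n < + suc m → n * suc m + n * n < suc m * suc m
  nM+nn<MM (inj₁ (_ , inj₂ pos)) =
    ℤₚ.drop‿+<+ (subst₂ ℤ._<_ (pos-norm n (suc m)) (sym (ℤₚ.pos-* (suc m) (suc m))) pos)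
  nM+nn<MM (inj₁ (_ , inj₁ (ℤ.+≤+ n≤0))) = ⊥-elim (<⇒≱ 0<n n≤0)
  nM+nn<MM (inj₂ (ℤ.+≤+ () , _))

fibIndex-decreasing : ∀ k → 2 + k ∸ fib (fibIndex (2 + k)) ≤ suc k
fibIndex-decreasing k with fibIndex-spec k
... | i , j≡2+i , _ rewrite j≡2+i = ∸-monoʳ-≤ (2 + k) (0<fib-suc (suc i))

aux-fuel-irrelevant : ∀ f g n → n ≤ f → n ≤ g → aux f n ≡ aux g n
aux-fuel-irrelevant zero    zero    _             _         _         = refl
aux-fuel-irrelevant zero    (suc g) zero          _         _         = refl
aux-fuel-irrelevant (suc f) zero    zero          _         _         = refl
aux-fuel-irrelevant (suc f) (suc g) zero          _         _         = refl
aux-fuel-irrelevant (suc f) (suc g) (suc zero)    _         _         = refl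
aux-fuel-irrelevant (suc f) (suc g) (suc (suc k)) (s≤s n≤f) (s≤s n≤g) =
  cong (ℤ._-_ (+ fib (suc (fibIndex (2 + k)))))
       (aux-fuel-irrelevant f g _ (≤-trans (fibIndex-decreasing k) n≤f)
                                  (≤-trans (fibIndex-decreasing k) n≤g))

a-recurrence : ∀ k i → fibIndex (2 + k) ≡ 2 + i →
               a (2 + k) ≡ + fib (3 + i) - a (2 + k ∸ fib (2 + i))
a-recurrence k i j≡2+i = begin
  a (2 + k)
    ≡⟨ cong (ℤ._-_ (+ fib (suc j))) (aux-fuel-irrelevant (suc k) _ _ (fibIndex-decreasing k) ≤-refl) ⟩
  + fib (suc j) - a (2 + k ∸ fib j)
    ≡⟨ cong (λ j → + fib (suc j) - a (2 + k ∸ fib j)) j≡2+i ⟩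
  + fib (3 + i) - a (2 + k ∸ fib (2 + i))
    ∎
  where
  open ≡-Reasoning
  j = fibIndex (2 + k)

fib-remainder-bounds : ∀ i {n} → FibBracket (2 + i) n →
                       0 < n ∸ fib (2 + i) × n ∸ fib (2 + i) ≤ fib (suc i)
fib-remainder-bounds i {n} (F<n , n≤F) =
  m<n⇒0<n∸m F<n ,
  subst (n ∸ fib (2 + i) ≤_) (m+n∸m≡n (fib (2 + i)) (fib (suc i))) (∸-monoˡ-≤ (fib (2 + i)) n≤F)

2∣x-m⇒2∣[f-x]-[m+f] : ∀ f x m → + 2 ∣ (x - + m) → + 2 ∣ ((+ f - x) - + (m + f))
2∣x-m⇒2∣[f-x]-[m+f] f x m 2∣x-m = ∣⇒∣ᵤ (subst (Signed._∣_ (+ 2)) (sym rearrange)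
  (∣m⇒∣-m (∣m∣n⇒∣m+n (∣ᵤ⇒∣ {i = x - + m} 2∣x-m) (∣n⇒∣m*n (+ m) Signed.∣-refl))))
  where
  open Signed using (∣ᵤ⇒∣; ∣⇒∣ᵤ; ∣m⇒∣-m; ∣m∣n⇒∣m+n; ∣n⇒∣m*n)
  negate : ∀ f x m → (f ℤ.- x) ℤ.- (m ℤ.+ f) ≡ ℤ.- ((x ℤ.- m) ℤ.+ m ℤ.* + 2)
  negate = ℤ-Solver.solve-∀
  rearrange : (+ f - x) - + (m + f) ≡ ℤ.- ((x - + m) ℤ.+ + m ℤ.* + 2)
  rearrange = trans (cong ((+ f - x) -_) (ℤₚ.pos-+ m f)) (negate (+ f) x (+ m))

a≡⌊nφ⌋-mod-2 : ∀ n → 0 < n → Σ ℕ λ m → Floorφ n m × + 2 ∣ (a n - + m)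
a≡⌊nφ⌋-mod-2 = <-rec _ step
  where
  step : ∀ n → (∀ {r} → r < n → 0 < r → Σ ℕ λ m → Floorφ r m × + 2 ∣ (a r - + m)) →
         0 < n → Σ ℕ λ m → Floorφ n m × + 2 ∣ (a n - + m)
  step 1 _ _ = 1 , Floorφ-1 , 2 ℕ.∣0
  step (suc (suc k)) rec _ with fibIndex-spec k
  ... | i , j≡2+i , bracket@(F<n , _) =
    let r = 2 + k ∸ fib (2 + i)
        0<r , r≤F = fib-remainder-bounds i bracket
        m , floor , parity = rec {r} (∸-monoʳ-< (0<fib-suc (suc i)) (<⇒≤ F<n)) 0<r
    in m + fib (3 + i) ,
       subst (λ n → Floorφ n (m + fib (3 + i))) (m∸n+n≡m (<⇒≤ F<n))
             (Floorφ-translate i 0<r r≤F floor) ,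
       subst (λ z → + 2 ∣ (z - + (m + fib (3 + i)))) (sym (a-recurrence k i j≡2+i))
             (2∣x-m⇒2∣[f-x]-[m+f] (fib (3 + i)) (a r) m parity)

proposition17 : (n : ℕ) → Σ ℕ (λ m → IsFloorNφ n m × (+ 2 ∣ (a n - + m)))
proposition17 zero = 0 , (z≤n , s≤s z≤n , s≤s z≤n) , 2 ℕ.∣0
proposition17 n@(suc _) =
  let m , floor , parity = a≡⌊nφ⌋-mod-2 n (s≤s z≤n)
  in m , Floorφ⇒IsFloorNφ (s≤s z≤n) floor , parity
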